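{- Let $\mathcal D$ be a maximal ASPD on an $n$-element set $A$. Let $a\in A$ and $\omega\in\mathcal D$ with $\omega(k)=a$. Then for every $j\le k$ there exists $\omega'\in\mathcal D$ with $\omega'(j)=a$. Consequently $$\operatorname{rich}(\mathcal D)=\max\{k\in[n]:\ \text{for every } a\in A \text{ there exists } \omega\in\mathcal D \text{ with } \omega(k)=a\}.$$
   Context: Preferences: bijections $\omega\colon[n]\to A$, written $\omega(1)\cdots\omega(n)$; $\mathcal L(A)$ all preferences; domain = subset of $\mathcal L(A)$; $\mathcal D_S$ = restrictions to $S\subseteq A$ keeping relative order; $x$ is a bottom alternative of $\mathcal D$ if $\omega(|A|)=x$ for some $\omega\in\mathcal D$. ASPD: for every 3-element $T\subseteq A$ some $x\in T$ is not a bottom alternative of $\mathcal D_T$; maximal: not properly contained in another ASPD in $\mathcal L(A)$. A domain $\mathcal D$ is $k$-rich if for every $j\le k$ and every $a\in A$ there is $\omega\in\mathcal D$ with $\omega(j)=a$; $\operatorname{rich}(\mathcal D)$ is the $k$ such that $\mathcal D$ is $k$-rich but not $(k+1)$-rich. -}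

module Defs where

open import Data.Nat as ℕ using (ℕ; suc; _≤_)
open import Data.Fin as Fin using (Fin; toℕ; _<_)
open import Data.Vec using (Vec; lookup)
open import Data.Product using (Σ; ∃; _×_; _,_)
open import Data.Sum using (_⊎_)
open import Relation.Binary.PropositionalEquality using (_≡_; _≢_)
open import Relation.Nullary using (¬_)
open import Function.Definitions using (Bijective)

-- The set A is Fin n.  A candidate preference is a vector v of length n:
-- position i (0-based Fin index, i.e. position toℕ i + 1 in the paper's
-- 1-based [n]) holds the alternative ω(toℕ i + 1) = lookup v i.
Pref : ℕ → Set
Pref n = Vec (Fin n) n

IsLinear : ∀ {n} → Pref n → Set
IsLinear v = Bijective _≡_ _≡_ (lookup v)

Domain : ℕ → Set₁
Domain n = Pref n → Set

_⊆_ : ∀ {n} → Domain n → Domain n → Set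
D ⊆ E = ∀ v → D v → E v

InL : ∀ {n} → Domain n → Set
InL D = ∀ v → D v → IsLinear v

Above : ∀ {n} → Pref n → Fin n → Fin n → Set
Above v y x = Σ _ λ i → Σ _ λ j → (i < j) × (lookup v i ≡ y) × (lookup v j ≡ x)

BottomOf : ∀ {n} → Domain n → Fin n → Fin n → Fin n → Set
BottomOf D x y z = ∃ λ v → D v × Above v y x × Above v z x

IsASPD : ∀ {n} → Domain n → Set
IsASPD D = InL D ×
  (∀ x y z → x ≢ y → y ≢ z → x ≢ z →
     ¬ BottomOf D x y z ⊎ ¬ BottomOf D y x z ⊎ ¬ BottomOf D z x y)

IsMaximalASPD : ∀ {n} → Domain n → Set₁
IsMaximalASPD {n} D = IsASPD D × (∀ (E : Domain n) → IsASPD E → D ⊆ E → E ⊆ D)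

-- ω(j) = a for a 1-based position j : ℕ (false unless 1 ≤ j ≤ n).
At : ∀ {n} → Pref n → ℕ → Fin n → Set
At v j a = Σ _ λ i → (suc (toℕ i) ≡ j) × (lookup v i ≡ a)

FullAt : ∀ {n} → Domain n → ℕ → Set
FullAt D j = ∀ a → ∃ λ v → D v × At v j a

KRich : ∀ {n} → Domain n → ℕ → Set
KRich D k = ∀ j → 1 ≤ j → j ≤ k → FullAt D j

IsRich : ∀ {n} → Domain n → ℕ → Set
IsRich D k = KRich D k × ¬ KRich D (suc k)

IsMaxFull : ∀ {n} → Domain n → ℕ → Set
IsMaxFull {n} D k = (1 ≤ k × k ≤ n × FullAt D k) ×
  (∀ k′ → 1 ≤ k′ → k′ ≤ n → FullAt D k′ → k′ ≤ k)

-- A maximal ASPD D is decidable: by maximality it consists of all linear orders that, on every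
-- triple, never put last the alternative that D never puts last there.
-- To move a = ω(k) up one place, look for an alternative b above a in ω that is free, i.e. already
-- a bottom alternative of D on every triple it forms with alternatives at or above a; then b sinks
-- by adjacent swaps to a's place without leaving D, lifting a by one. If there is no such b, every
-- alternative above a in ω stays above a in every member of D, yet swapping a with its upper
-- neighbour in ω yields an order that maximality forces into D. Hence being full at a position is
-- inherited by all smaller positions, and rich(D) is the largest full position.

module Submission where

open import Defs
open import Data.Nat using (ℕ; _≤_)
open import Data.Fin using (Fin) renaming (_≤_ to _≤ᶠ_)
open import Data.Vec using (lookup)
open import Data.Product using (Σ; ∃; _×_)
open import Relation.Binary.PropositionalEquality using (_≡_)

open import Data.Empty using (⊥; ⊥-elim)
open import Data.Fin as Fin using (toℕ; fromℕ<)
open import Data.Fin.Induction using (>-wellFounded)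
open import Data.Fin.Permutation.Components using (transpose; transpose-inverse)
open import Data.Fin.Properties
  using (_≟_; _<?_; any?; all?; toℕ-injective; toℕ-fromℕ<; toℕ<n; ≤∧≢⇒<; <-cmp; <-asym; <-trans; <-irrefl)
open import Data.Nat using (zero; suc; _+_; z≤n; s≤s)
import Data.Nat.Properties as ℕ
open import Data.Product using (_,_; proj₁; proj₂)
open import Data.Sum using (_⊎_; inj₁; inj₂)
open import Data.Unit using (⊤; tt)
open import Data.Vec using (Vec; []; _∷_; tabulate; allFin)
open import Data.Vec.Properties using (lookup∘tabulate; lookup-allFin)
open import Function using (_∘_; case_of_)
open import Induction.WellFounded using (WellFounded; module Subrelation; module All)
import Relation.Binary.Construct.On as On
open import Relation.Binary using (tri<; tri≈; tri>)
open import Relation.Binary.PropositionalEquality using (_≢_; refl; sym; trans; cong; subst; subst₂; ≢-sym)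
open import Relation.Nullary using (¬_; Dec; yes; no)
open import Relation.Nullary.Decidable using (map′; _×-dec_; _⊎-dec_; _→-dec_; ¬?; dec-true; dec-false)
open import Relation.Unary using (Decidable)

anyVec? : ∀ {n} m {P : Vec (Fin n) m → Set} → Decidable P → Dec (∃ P)
anyVec? zero    P? = map′ ([] ,_) (λ { ([] , p) → p }) (P? [])
anyVec? (suc m) P? = map′ (λ (x , v , p) → x ∷ v , p) (λ { (x ∷ v , p) → x , v , p })
  (any? λ x → anyVec? m λ v → P? (x ∷ v))

module _ {n} {q q′ : Fin n} (adj : toℕ q′ ≡ suc (toℕ q)) where

  adjacent⇒< : q Fin.< q′
  adjacent⇒< = ℕ.≤-reflexive (sym adj)

  adjacent⇒≢ : q ≢ q′
  adjacent⇒≢ q≡q′ = ℕ.1+n≢n (sym (trans (cong toℕ q≡q′) adj))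

successor : ∀ {n} {q k : Fin n} → q Fin.< k → ∃ λ q′ → toℕ q′ ≡ suc (toℕ q)
successor {k = k} q<k = fromℕ< (ℕ.≤-<-trans q<k (toℕ<n k)) , toℕ-fromℕ< _

bounded-greatest : ∀ {P : ℕ → Set} → Decidable P → ∀ {m t} → m ≤ t → P m →
  ∃ λ r → m ≤ r × r ≤ t × P r × (∀ k → k ≤ t → P k → k ≤ r)
bounded-greatest P? {t = zero} z≤n Pm = 0 , z≤n , z≤n , Pm , λ { _ z≤n _ → z≤n }
bounded-greatest {P} P? {m} {suc t} m≤1+t Pm with P? (suc t)
... | yes P[1+t] = suc t , m≤1+t , ℕ.≤-refl , P[1+t] , λ _ k≤1+t _ → k≤1+t
... | no ¬P[1+t] =
  let r , m≤r , r≤t , Pr , greatest = bounded-greatest P? (below m≤1+t Pm) Pm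
  in r , m≤r , ℕ.m≤n⇒m≤1+n r≤t , Pr , λ k k≤1+t Pk → greatest k (below k≤1+t Pk) Pk
  where
  below : ∀ {k} → k ≤ suc t → P k → k ≤ t
  below k≤1+t Pk = ℕ.≤-pred (ℕ.≤∧≢⇒< k≤1+t λ { refl → ¬P[1+t] Pk })

module Linear {n} (v : Pref n) (lin : IsLinear v) where

  lookup-injective : ∀ {i j} → lookup v i ≡ lookup v j → i ≡ j
  lookup-injective = proj₁ lin

  pos : Fin n → Fin n
  pos y = proj₁ (proj₂ lin y)

  lookup-pos : ∀ y → lookup v (pos y) ≡ y
  lookup-pos y = proj₂ (proj₂ lin y) refl

  pos-lookup : ∀ i → pos (lookup v i) ≡ i
  pos-lookup i = lookup-injective (lookup-pos (lookup v i))

  Above⇒pos< : ∀ {y x} → Above v y x → pos y Fin.< pos x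
  Above⇒pos< (i , j , i<j , refl , refl) = subst₂ Fin._<_ (sym (pos-lookup i)) (sym (pos-lookup j)) i<j

  pos<⇒Above : ∀ {y x} → pos y Fin.< pos x → Above v y x
  pos<⇒Above pos< = _ , _ , pos< , lookup-pos _ , lookup-pos _

  Above-asym : ∀ {y x} → Above v y x → ¬ Above v x y
  Above-asym y>x x>y = <-asym (Above⇒pos< y>x) (Above⇒pos< x>y)

  Above-irrefl : ∀ {y x} → Above v y x → y ≢ x
  Above-irrefl y>x refl = Above-asym y>x y>x

  Above-trans : ∀ {z y x} → Above v z y → Above v y x → Above v z x
  Above-trans z>y y>x = pos<⇒Above (<-trans (Above⇒pos< z>y) (Above⇒pos< y>x))

  Above-total : ∀ {x y} → x ≢ y → Above v x y ⊎ Above v y x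
  Above-total {x} {y} x≢y with <-cmp (pos x) (pos y)
  ... | tri< pos< _ _ = inj₁ (pos<⇒Above pos<)
  ... | tri≈ _ pos≡ _ = ⊥-elim (x≢y (trans (sym (lookup-pos x)) (trans (cong (lookup v) pos≡) (lookup-pos y))))
  ... | tri> _ _ pos> = inj₂ (pos<⇒Above pos>)

  Below-wellFounded : WellFounded (λ x y → Above v y x)
  Below-wellFounded = Subrelation.wellFounded Above⇒pos< (On.wellFounded pos >-wellFounded)

open Linear public

Above? : ∀ {n} (v : Pref n) y x → Dec (Above v y x)
Above? v y x = any? λ i → any? λ j → i <? j ×-dec lookup v i ≟ y ×-dec lookup v j ≟ x

IsLinear? : ∀ {n} (v : Pref n) → Dec (IsLinear v)
IsLinear? v = map′ (λ (inj , surj) → (λ {i} {j} → inj i j) , λ y → proj₁ (surj y) , λ { refl → proj₂ (surj y) })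
                   (λ (inj , surj) → (λ i j → inj) , λ y → proj₁ (surj y) , proj₂ (surj y) refl)
  ((all? λ i → all? λ j → lookup v i ≟ lookup v j →-dec i ≟ j) ×-dec (all? λ y → any? λ i → lookup v i ≟ y))

allFin-linear : ∀ {n} → IsLinear (allFin n)
allFin-linear = (λ {i} {j} e → trans (sym (lookup-allFin i)) (trans e (lookup-allFin j)))
              , λ y → y , λ { refl → lookup-allFin y }

module Transposition {n} {q q′ : Fin n} (adj : toℕ q′ ≡ suc (toℕ q)) where

  private
    τ : Fin n → Fin n
    τ = transpose q q′

    q<q′ : q Fin.< q′
    q<q′ = adjacent⇒< adj

    τ-q : τ q ≡ q′
    τ-q rewrite dec-true (q ≟ q) refl = refl

    τ-q′ : τ q′ ≡ q
    τ-q′ rewrite dec-false (q′ ≟ q) (≢-sym (adjacent⇒≢ adj)) | dec-true (q′ ≟ q′) refl = refl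

    τ-other : ∀ {r} → r ≢ q → r ≢ q′ → τ r ≡ r
    τ-other {r} r≢q r≢q′ rewrite dec-false (r ≟ q) r≢q | dec-false (r ≟ q′) r≢q′ = refl

    data Place : Fin n → Set where
      at-q  : Place q
      at-q′ : Place q′
      apart : ∀ {r} → r ≢ q → r ≢ q′ → Place r

    place : ∀ r → Place r
    place r with r ≟ q | r ≟ q′
    ... | yes refl | _        = at-q
    ... | no _     | yes refl = at-q′
    ... | no r≢q   | no r≢q′  = apart r≢q r≢q′

    apart-side : ∀ {r} → r ≢ q → r ≢ q′ → r Fin.< q ⊎ q′ Fin.< r
    apart-side {r} r≢q r≢q′ with <-cmp r q | <-cmp q′ r
    ... | tri< r<q _ _ | _ = inj₁ r<q
    ... | tri≈ _ r≡q _ | _ = ⊥-elim (r≢q r≡q)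
    ... | tri> _ _ q<r | tri< q′<r _ _ = inj₂ q′<r
    ... | tri> _ _ q<r | tri≈ _ q′≡r _ = ⊥-elim (r≢q′ (sym q′≡r))
    ... | tri> _ _ q<r | tri> _ _ r<q′ = ⊥-elim (ℕ.<-irrefl refl (ℕ.<-≤-trans r<q′ (subst₂ _≤_ (sym adj) refl q<r)))

    τ-monotone : ∀ {i j} → i Fin.< j → τ i Fin.< τ j ⊎ (i ≡ q × j ≡ q′)
    τ-monotone {i} {j} i<j with place i | place j
    ... | at-q  | at-q  = ⊥-elim (<-irrefl refl i<j)
    ... | at-q  | at-q′ = inj₂ (refl , refl)
    ... | at-q  | apart j≢q j≢q′ rewrite τ-q | τ-other j≢q j≢q′ with apart-side j≢q j≢q′
    ...   | inj₁ j<q  = ⊥-elim (<-asym i<j j<q)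
    ...   | inj₂ q′<j = inj₁ q′<j
    τ-monotone i<j | at-q′ | at-q  = ⊥-elim (<-asym i<j q<q′)
    τ-monotone i<j | at-q′ | at-q′ = ⊥-elim (<-irrefl refl i<j)
    τ-monotone i<j | at-q′ | apart j≢q j≢q′ rewrite τ-q′ | τ-other j≢q j≢q′ = inj₁ (<-trans q<q′ i<j)
    τ-monotone i<j | apart i≢q i≢q′ | at-q rewrite τ-q | τ-other i≢q i≢q′ = inj₁ (<-trans i<j q<q′)
    τ-monotone i<j | apart i≢q i≢q′ | at-q′ rewrite τ-q′ | τ-other i≢q i≢q′ with apart-side i≢q i≢q′
    ...   | inj₁ i<q  = inj₁ i<q
    ...   | inj₂ q′<i = ⊥-elim (<-asym i<j q′<i)
    τ-monotone i<j | apart i≢q i≢q′ | apart j≢q j≢q′ rewrite τ-other i≢q i≢q′ | τ-other j≢q j≢q′ = inj₁ i<j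

  swap : Pref n → Pref n
  swap μ = tabulate (lookup μ ∘ τ)

  module _ (μ : Pref n) where

    lookup-swap : ∀ r → lookup (swap μ) r ≡ lookup μ (τ r)
    lookup-swap = lookup∘tabulate (lookup μ ∘ τ)

    lookup-swap-q : lookup (swap μ) q ≡ lookup μ q′
    lookup-swap-q = trans (lookup-swap q) (cong (lookup μ) τ-q)

    lookup-swap-q′ : lookup (swap μ) q′ ≡ lookup μ q
    lookup-swap-q′ = trans (lookup-swap q′) (cong (lookup μ) τ-q′)

    lookup-swap-other : ∀ {r} → r ≢ q → r ≢ q′ → lookup (swap μ) r ≡ lookup μ r
    lookup-swap-other r≢q r≢q′ = trans (lookup-swap _) (cong (lookup μ) (τ-other r≢q r≢q′))

    swap-linear : IsLinear μ → IsLinear (swap μ)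
    swap-linear (inj , surj) =
        (λ {i} {j} e → trans (sym (transpose-inverse q′ q))
          (trans (cong (transpose q′ q) (inj (trans (sym (lookup-swap i)) (trans e (lookup-swap j)))))
                 (transpose-inverse q′ q)))
      , λ y → transpose q′ q (proj₁ (surj y))
            , λ { refl → trans (lookup-swap _) (trans (cong (lookup μ) (transpose-inverse q q′)) (proj₂ (surj y) refl)) }

    swap-Above : ∀ {y x} → Above (swap μ) y x → Above μ y x ⊎ (y ≡ lookup μ q′ × x ≡ lookup μ q)
    swap-Above (i , j , i<j , refl , refl) with τ-monotone i<j
    ... | inj₁ τi<τj      = inj₁ (τ i , τ j , τi<τj , sym (lookup-swap i) , sym (lookup-swap j))
    ... | inj₂ (refl , refl) = inj₂ (lookup-swap-q , lookup-swap-q′)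

open Transposition public using (swap; lookup-swap-q; lookup-swap-q′; lookup-swap-other; swap-linear; swap-Above)

module _ {n : ℕ} where

  BottomIn : Pref n → Fin n → Fin n → Fin n → Set
  BottomIn v x y z = Above v y x × Above v z x

  BottomIn? : ∀ v x y z → Dec (BottomIn v x y z)
  BottomIn? v x y z = Above? v y x ×-dec Above? v z x

  Distinct : Fin n → Fin n → Fin n → Set
  Distinct x y z = x ≢ y × y ≢ z × x ≢ z

  Distinct? : ∀ x y z → Dec (Distinct x y z)
  Distinct? x y z = ¬? (x ≟ y) ×-dec ¬? (y ≟ z) ×-dec ¬? (x ≟ z)

  SomeNeverBottom : Domain n → Fin n → Fin n → Fin n → Set
  SomeNeverBottom E x y z = ¬ BottomOf E x y z ⊎ ¬ BottomOf E y x z ⊎ ¬ BottomOf E z x y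

  _∪｛_｝ : Domain n → Pref n → Domain n
  (E ∪｛ ν ｝) w = E w ⊎ w ≡ ν

  BottomOf-comm : ∀ {E : Domain n} {x y z} → BottomOf E x y z → BottomOf E x z y
  BottomOf-comm (v , v∈E , y>x , z>x) = v , v∈E , z>x , y>x

  SomeNeverBottom-comm : ∀ {E : Domain n} {x y z} → SomeNeverBottom E y x z → SomeNeverBottom E x y z
  SomeNeverBottom-comm {E} (inj₁ y↑)        = inj₂ (inj₁ y↑)
  SomeNeverBottom-comm {E} (inj₂ (inj₁ x↑)) = inj₁ x↑
  SomeNeverBottom-comm {E} (inj₂ (inj₂ z↑)) = inj₂ (inj₂ (z↑ ∘ BottomOf-comm {E}))

  SomeNeverBottom-rotate : ∀ {E : Domain n} {x y z} → SomeNeverBottom E z x y → SomeNeverBottom E x y z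
  SomeNeverBottom-rotate {E} (inj₁ z↑)        = inj₂ (inj₂ z↑)
  SomeNeverBottom-rotate {E} (inj₂ (inj₁ x↑)) = inj₁ (x↑ ∘ BottomOf-comm {E})
  SomeNeverBottom-rotate {E} (inj₂ (inj₂ y↑)) = inj₂ (inj₁ (y↑ ∘ BottomOf-comm {E}))

  IsASPD-from : ∀ {D E : Domain n} → IsASPD D → InL E →
    (∀ {x y z} → Distinct x y z → ¬ BottomOf D x y z → SomeNeverBottom E x y z) → IsASPD E
  IsASPD-from (_ , D-aspd) E-linear cover = E-linear , λ x y z x≢y y≢z x≢z → case D-aspd x y z x≢y y≢z x≢z of λ
    { (inj₁ x↑)        → cover (x≢y , y≢z , x≢z) x↑
    ; (inj₂ (inj₁ y↑)) → SomeNeverBottom-comm (cover (≢-sym x≢y , x≢z , y≢z) y↑)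
    ; (inj₂ (inj₂ z↑)) → SomeNeverBottom-rotate (cover (≢-sym x≢z , x≢y , ≢-sym y≢z) z↑) }

  singleton-isASPD : ∀ {v : Pref n} → IsLinear v → IsASPD (_≡ v)
  singleton-isASPD {v} v-linear = (λ { _ refl → v-linear }) , λ x y z x≢y _ _ → case Above-total v v-linear x≢y of λ
    { (inj₁ x>y) → inj₁ λ { (_ , refl , y>x , _) → Above-asym v v-linear x>y y>x }
    ; (inj₂ y>x) → inj₂ (inj₁ λ { (_ , refl , x>y , _) → Above-asym v v-linear x>y y>x }) }

module MaximalASPD {n} {D : Domain n} (maximal : IsMaximalASPD D) where

  linear : ∀ {v} → D v → IsLinear v
  linear = proj₁ (proj₁ maximal) _

  ASPD⊆D : ∀ {E} → IsASPD E → D ⊆ E → E ⊆ D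
  ASPD⊆D = proj₂ maximal _

  insert-∈ : ∀ {ν} → IsLinear ν →
    (∀ {x y z} → Distinct x y z → ¬ BottomOf D x y z → SomeNeverBottom (D ∪｛ ν ｝) x y z) → D ν
  insert-∈ {ν} ν-linear cover = ASPD⊆D (IsASPD-from (proj₁ maximal) E-linear cover) (λ _ → inj₁) ν (inj₂ refl)
    where
    E-linear : InL (D ∪｛ ν ｝)
    E-linear _ (inj₁ w∈D) = linear w∈D
    E-linear _ (inj₂ refl) = ν-linear

  -- Swapping x = μ q with the alternative w = μ q′ just below it only creates the bottom triples
  -- {x, w, z} with z above x; each must already be one in D, or have z above w throughout D.
  swap-∈ : ∀ {μ q q′} (adj : toℕ q′ ≡ suc (toℕ q)) → D μ →
    (∀ {z} → z ≢ lookup μ q′ → Above μ z (lookup μ q) →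
       BottomOf D (lookup μ q) (lookup μ q′) z ⊎ (∀ {ρ} → D ρ → Above ρ z (lookup μ q′))) →
    D (swap adj μ)
  swap-∈ {μ} {q} {q′} adj μ∈D side = insert-∈ (swap-linear adj μ (linear μ∈D)) cover
    where
    ν : Pref n
    ν = swap adj μ

    stays-above : ∀ {z} → Above μ z (lookup μ q) → ¬ Above ν (lookup μ q) z
    stays-above z>x x>z with swap-Above adj μ x>z
    ... | inj₁ x>z       = Above-asym μ (linear μ∈D) z>x x>z
    ... | inj₂ (_ , z≡x) = Above-irrefl μ (linear μ∈D) z>x z≡x

    z-never-bottom : ∀ {z} → z ≢ lookup μ q′ → Above μ z (lookup μ q) →
      ¬ BottomOf D (lookup μ q) (lookup μ q′) z → ¬ BottomOf (D ∪｛ ν ｝) z (lookup μ q) (lookup μ q′)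
    z-never-bottom z≢w z>x x↑ with side z≢w z>x
    ... | inj₁ x↓ = ⊥-elim (x↑ x↓)
    ... | inj₂ z>w = λ
      { (ρ , inj₁ ρ∈D , _ , w>z)  → Above-asym ρ (linear ρ∈D) (z>w ρ∈D) w>z
      ; (_ , inj₂ refl , x>z , _) → stays-above z>x x>z }

    cover : ∀ {x y z} → Distinct x y z → ¬ BottomOf D x y z → SomeNeverBottom (D ∪｛ ν ｝) x y z
    cover {x} {y} {z} (_ , y≢z , _) x↑ with BottomIn? ν x y z
    ... | no x↑ν = inj₁ λ { (_ , inj₁ ρ∈D , x↓) → x↑ (_ , ρ∈D , x↓) ; (_ , inj₂ refl , x↓) → x↑ν x↓ }
    ... | yes (y>x , z>x) with swap-Above adj μ y>x | swap-Above adj μ z>x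
    ...   | inj₁ y>x′ | inj₁ z>x′ = ⊥-elim (x↑ (μ , μ∈D , y>x′ , z>x′))
    ...   | inj₂ (refl , refl) | inj₁ z>x′ = inj₂ (inj₂ (z-never-bottom (≢-sym y≢z) z>x′ x↑))
    ...   | inj₁ y>x′ | inj₂ (refl , refl) = inj₂ (inj₁ (z-never-bottom y≢z y>x′ (x↑ ∘ BottomOf-comm {E = D})))
    ...   | inj₂ (refl , _) | inj₂ (refl , _) = ⊥-elim (y≢z refl)

  private
    never-bottom : ∀ {x y z} → Distinct x y z → SomeNeverBottom D x y z
    never-bottom (x≢y , y≢z , x≢z) = proj₂ (proj₁ maximal) _ _ _ x≢y y≢z x≢z

  Obeys : Pref n → ∀ {x y z} → SomeNeverBottom D x y z → Set
  Obeys v {x} {y} {z} (inj₁ _)        = ¬ BottomIn v x y z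
  Obeys v {x} {y} {z} (inj₂ (inj₁ _)) = ¬ BottomIn v y x z
  Obeys v {x} {y} {z} (inj₂ (inj₂ _)) = ¬ BottomIn v z x y

  Obeys? : ∀ v {x y z} (s : SomeNeverBottom D x y z) → Dec (Obeys v s)
  Obeys? v {x} {y} {z} (inj₁ _)        = ¬? (BottomIn? v x y z)
  Obeys? v {x} {y} {z} (inj₂ (inj₁ _)) = ¬? (BottomIn? v y x z)
  Obeys? v {x} {y} {z} (inj₂ (inj₂ _)) = ¬? (BottomIn? v z x y)

  ObeysOn : Pref n → ∀ x y z → Dec (Distinct x y z) → Set
  ObeysOn v x y z (yes d) = Obeys v (never-bottom d)
  ObeysOn v x y z (no _)  = ⊤

  ObeysOn? : ∀ v x y z d → Dec (ObeysOn v x y z d)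
  ObeysOn? v x y z (yes d) = Obeys? v (never-bottom d)
  ObeysOn? v x y z (no _)  = yes tt

  -- An ASPD containing D, hence equal to D by maximality; unlike D, it is visibly decidable.
  Obedient : Domain n
  Obedient v = IsLinear v × ∀ x y z → ObeysOn v x y z (Distinct? x y z)

  member-obeys : ∀ {v x y z} → D v → (s : SomeNeverBottom D x y z) → Obeys v s
  member-obeys v∈D (inj₁ x↑)        x↓ = x↑ (_ , v∈D , x↓)
  member-obeys v∈D (inj₂ (inj₁ y↑)) y↓ = y↑ (_ , v∈D , y↓)
  member-obeys v∈D (inj₂ (inj₂ z↑)) z↓ = z↑ (_ , v∈D , z↓)

  D⊆Obedient : D ⊆ Obedient
  D⊆Obedient v v∈D = linear v∈D , λ x y z → obeysOn x y z (Distinct? x y z)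
    where
    obeysOn : ∀ x y z d → ObeysOn v x y z d
    obeysOn x y z (yes d) = member-obeys v∈D (never-bottom d)
    obeysOn x y z (no _)  = tt

  obeyed-never-bottom : ∀ {x y z} (s : SomeNeverBottom D x y z) → (∀ {v} → Obedient v → Obeys v s) →
    SomeNeverBottom Obedient x y z
  obeyed-never-bottom (inj₁ _)        obeys = inj₁ λ (_ , o , x↓) → obeys o x↓
  obeyed-never-bottom (inj₂ (inj₁ _)) obeys = inj₂ (inj₁ λ (_ , o , y↓) → obeys o y↓)
  obeyed-never-bottom (inj₂ (inj₂ _)) obeys = inj₂ (inj₂ λ (_ , o , z↓) → obeys o z↓)

  Obedient-isASPD : IsASPD Obedient
  Obedient-isASPD = (λ _ → proj₁) , λ x y z x≢y y≢z x≢z →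
    never-bottom-on (x≢y , y≢z , x≢z) (Distinct? x y z) (λ o → proj₂ o x y z)
    where
    never-bottom-on : ∀ {x y z} → Distinct x y z → (d : Dec (Distinct x y z)) →
      (∀ {v} → Obedient v → ObeysOn v x y z d) → SomeNeverBottom Obedient x y z
    never-bottom-on _    (yes d)    obeys = obeyed-never-bottom (never-bottom d) obeys
    never-bottom-on dist (no ¬dist) _     = ⊥-elim (¬dist dist)

  D? : Decidable D
  D? v = map′ (ASPD⊆D Obedient-isASPD D⊆Obedient v) (D⊆Obedient v)
    (IsLinear? v ×-dec all? λ x → all? λ y → all? λ z → ObeysOn? v x y z (Distinct? x y z))

  BottomOf? : ∀ x y z → Dec (BottomOf D x y z)
  BottomOf? x y z = anyVec? n λ v → D? v ×-dec BottomIn? v x y z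

  nonempty : ∃ D
  nonempty with anyVec? n D?
  ... | yes ∃D = ∃D
  ... | no ∄D  = ⊥-elim (∄D (allFin n , ASPD⊆D (singleton-isASPD allFin-linear) (λ v v∈D → ⊥-elim (∄D (v , v∈D))) _ refl))

  module Raise {ω} (ω∈D : D ω) {p k : Fin n} (adj : toℕ k ≡ suc (toℕ p)) where

    private
      a : Fin n
      a = lookup ω k

    AtOrAbove : Fin n → Set
    AtOrAbove c = c ≡ a ⊎ Above ω c a

    -- A free alternative can be pushed down past a by adjacent swaps without leaving D.
    Free : Fin n → Set
    Free b = ∀ c d → AtOrAbove c → AtOrAbove d → Distinct b c d → BottomOf D b c d

    Free? : Decidable Free
    Free? b = all? λ c → all? λ d → (c ≟ a ⊎-dec Above? ω c a) →-dec (d ≟ a ⊎-dec Above? ω d a) →-dec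
      Distinct? b c d →-dec BottomOf? b c d

    KeepsTop : Pref n → Set
    KeepsTop μ = D μ × lookup μ k ≡ a × (∀ {c} → Above μ c a → Above ω c a)

    swap-free-∈ : ∀ {μ q q′} (adj′ : toℕ q′ ≡ suc (toℕ q)) → q′ ≤ᶠ k → KeepsTop μ → Free (lookup μ q) →
      D (swap adj′ μ)
    swap-free-∈ {μ} {q} {q′} adj′ q′≤k (μ∈D , μk≡a , μ⊆ω) b-free = swap-∈ adj′ μ∈D λ z≢w z>b →
      inj₁ (b-free _ _ w↑ (inj₂ (μ⊆ω (Above-trans μ μ-linear z>b b>a))) (b≢w , ≢-sym z≢w , ≢-sym (Above-irrefl μ μ-linear z>b)))
      where
      μ-linear : IsLinear μ
      μ-linear = linear μ∈D

      b>a : Above μ (lookup μ q) a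
      b>a = q , k , ℕ.<-≤-trans (adjacent⇒< adj′) q′≤k , refl , μk≡a

      b≢w : lookup μ q ≢ lookup μ q′
      b≢w b≡w = adjacent⇒≢ adj′ (lookup-injective μ μ-linear b≡w)

      w↑ : AtOrAbove (lookup μ q′)
      w↑ with q′ ≟ k
      ... | yes q′≡k = inj₁ (trans (cong (lookup μ) q′≡k) μk≡a)
      ... | no q′≢k  = inj₂ (μ⊆ω (q′ , k , ≤∧≢⇒< q′≤k q′≢k , refl , μk≡a))

    swap-keepsTop : ∀ {μ q q′} (adj′ : toℕ q′ ≡ suc (toℕ q)) → q′ Fin.< k → KeepsTop μ → Free (lookup μ q) →
      KeepsTop (swap adj′ μ)
    swap-keepsTop {μ} {q} {q′} adj′ q′<k top@(μ∈D , μk≡a , μ⊆ω) b-free =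
      swap-free-∈ adj′ (ℕ.<⇒≤ q′<k) top b-free , trans (lookup-swap-other adj′ μ k≢q k≢q′) μk≡a , ν⊆ω
      where
      k≢q′ : k ≢ q′
      k≢q′ k≡q′ = <-irrefl (sym k≡q′) q′<k

      k≢q : k ≢ q
      k≢q k≡q = <-irrefl (sym k≡q) (<-trans (adjacent⇒< adj′) q′<k)

      ν⊆ω : ∀ {c} → Above (swap adj′ μ) c a → Above ω c a
      ν⊆ω c>a with swap-Above adj′ μ c>a
      ... | inj₁ c>a′      = μ⊆ω c>a′
      ... | inj₂ (_ , a≡b) = ⊥-elim (k≢q (lookup-injective μ (linear μ∈D) (trans μk≡a a≡b)))

    sink : ∀ t {μ q} → t + suc (toℕ q) ≡ toℕ k → KeepsTop μ → Free (lookup μ q) → ∃ λ ν → D ν × lookup ν p ≡ a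
    sink zero {μ} q+1≡k top@(_ , μk≡a , _) b-free with toℕ-injective (ℕ.suc-injective (trans q+1≡k adj))
    ... | refl = swap adj μ , swap-free-∈ adj ℕ.≤-refl top b-free , trans (lookup-swap-q adj μ) μk≡a
    sink (suc t) {μ} {q} q+t≡k top b-free =
      sink t q′+t≡k (swap-keepsTop adj′ q′<k top b-free) (subst Free (sym (lookup-swap-q′ adj′ μ)) b-free)
      where
      q<k : q Fin.< k
      q<k = subst (suc (toℕ q) ≤_) q+t≡k (ℕ.m≤n+m (suc (toℕ q)) (suc t))

      q′ : Fin n
      q′ = proj₁ (successor q<k)

      adj′ : toℕ q′ ≡ suc (toℕ q)
      adj′ = proj₂ (successor q<k)

      q′+t≡k : t + suc (toℕ q′) ≡ toℕ k
      q′+t≡k = trans (cong (λ m → t + suc m) adj′) (trans (ℕ.+-suc t (suc (toℕ q))) q+t≡k)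

      q′<k : q′ Fin.< k
      q′<k = subst₂ _≤_ (cong suc (sym adj′)) q+t≡k (s≤s (ℕ.m≤n+m (suc (toℕ q)) t))

    module _ (unfree : ∀ {c} → Above ω c a → ¬ Free c) where

      -- Induction from the bottom of ρ: the lowest alternative above a in ω that ρ ranks below a would be free.
      above-everywhere : ∀ {ρ} → D ρ → ∀ {c} → Above ω c a → Above ρ c a
      above-everywhere {ρ} ρ∈D {c} = All.wfRec (Below-wellFounded ρ ρ-linear) _ (λ c → Above ω c a → Above ρ c a) step c
        where
        ρ-linear : IsLinear ρ
        ρ-linear = linear ρ∈D

        step : ∀ c → (∀ {d} → Above ρ c d → Above ω d a → Above ρ d a) → Above ω c a → Above ρ c a
        step c IH c>a with Above-total ρ ρ-linear (Above-irrefl ω (linear ω∈D) c>a)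
        ... | inj₁ c>a′ = c>a′
        ... | inj₂ a>c  = ⊥-elim (unfree c>a λ d e d↑ e↑ (c≢d , _ , c≢e) → ρ , ρ∈D , over d↑ (≢-sym c≢d) , over e↑ (≢-sym c≢e))
          where
          over : ∀ {d} → AtOrAbove d → d ≢ c → Above ρ d c
          over (inj₁ refl) _ = a>c
          over (inj₂ d>a) d≢c with Above-total ρ ρ-linear d≢c
          ... | inj₁ d>c = d>c
          ... | inj₂ c>d = Above-trans ρ ρ-linear (IH c>d d>a) a>c

      no-free-impossible : ⊥
      no-free-impossible = Above-asym ν (linear ν∈D) (above-everywhere ν∈D b>a) a>b
        where
        ν : Pref n
        ν = swap adj ω

        p<k : p Fin.< k
        p<k = adjacent⇒< adj

        b>a : Above ω (lookup ω p) a
        b>a = p , k , p<k , refl , refl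

        ν∈D : D ν
        ν∈D = swap-∈ adj ω∈D λ _ z>b → inj₂ λ ρ∈D → above-everywhere ρ∈D (Above-trans ω (linear ω∈D) z>b b>a)

        a>b : Above ν a (lookup ω p)
        a>b = p , k , p<k , lookup-swap-q adj ω , lookup-swap-q′ adj ω

    raise : ∃ λ ν → D ν × lookup ν p ≡ a
    raise with any? (λ c → Above? ω c a ×-dec Free? c)
    ... | yes (_ , (i , j , i<k , refl , ωj≡a) , b-free) with lookup-injective ω (linear ω∈D) ωj≡a
    ...   | refl = let t , i+t≡k = ℕ.m≤n⇒∃[o]m+o≡n i<k
                   in sink t (trans (ℕ.+-comm t (suc (toℕ i))) i+t≡k) (ω∈D , refl , λ c>a → c>a) b-free
    raise | no none = ⊥-elim (no-free-impossible λ c>a c-free → none (_ , c>a , c-free))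

  move-up-by : ∀ t {ω j k} → D ω → t + toℕ j ≡ toℕ k → ∃ λ ν → D ν × lookup ν j ≡ lookup ω k
  move-up-by zero    ω∈D j≡k with toℕ-injective j≡k
  ... | refl = _ , ω∈D , refl
  move-up-by (suc t) {j = j} {k} ω∈D j+t≡k =
    let j′ , adj = successor j<k
        ν , ν∈D , νj′≡ωk = move-up-by t ω∈D (trans (cong (t +_) adj) (trans (ℕ.+-suc t (toℕ j)) j+t≡k))
        ν′ , ν′∈D , ν′j≡νj′ = Raise.raise ν∈D adj
    in ν′ , ν′∈D , trans ν′j≡νj′ νj′≡ωk
    where
    j<k : j Fin.< k
    j<k = subst (suc (toℕ j) ≤_) j+t≡k (s≤s (ℕ.m≤n+m (toℕ j) t))

  move-up : ∀ {ω j k} → D ω → j ≤ᶠ k → ∃ λ ν → D ν × lookup ν j ≡ lookup ω k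
  move-up {j = j} ω∈D j≤k =
    let t , j+t≡k = ℕ.m≤n⇒∃[o]m+o≡n j≤k in move-up-by t ω∈D (trans (ℕ.+-comm t (toℕ j)) j+t≡k)

  At-downward : ∀ {v r j a} → D v → At v r a → 1 ≤ j → j ≤ r → ∃ λ ν → D ν × At ν j a
  At-downward v∈D (i , refl , refl) (s≤s z≤n) (s≤s j≤i) =
    let j<n = ℕ.≤-<-trans j≤i (toℕ<n i)
        ν , ν∈D , νj≡vi = move-up v∈D (subst (_≤ toℕ i) (sym (toℕ-fromℕ< j<n)) j≤i)
    in ν , ν∈D , fromℕ< j<n , cong suc (toℕ-fromℕ< j<n) , νj≡vi

  FullAt-downward : ∀ {j r} → 1 ≤ j → j ≤ r → FullAt D r → FullAt D j
  FullAt-downward 1≤j j≤r full a = let v , v∈D , at = full a in At-downward v∈D at 1≤j j≤r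

  FullAt-1 : FullAt D 1
  FullAt-1 a = let v , v∈D = nonempty
                   v-linear = linear v∈D
               in At-downward v∈D (pos v v-linear a , refl , lookup-pos v v-linear a) (s≤s z≤n) (s≤s z≤n)

  FullAt⇒≤ : ∀ {j} → Fin n → FullAt D j → j ≤ n
  FullAt⇒≤ a full with full a
  ... | _ , _ , i , refl , _ = toℕ<n i

  FullAt? : ∀ j → Dec (FullAt D j)
  FullAt? j = all? λ a → anyVec? n λ v → D? v ×-dec any? λ i → suc (toℕ i) ℕ.≟ j ×-dec lookup v i ≟ a

  rich-is-greatest-full : 1 ≤ n → Σ ℕ λ r → IsRich D r × IsMaxFull D r
  rich-is-greatest-full 1≤n =
    let r , 1≤r , r≤n , full-r , greatest = bounded-greatest FullAt? 1≤n FullAt-1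
        not-richer : ¬ KRich D (suc r)
        not-richer rich = let full = rich (suc r) (s≤s z≤n) ℕ.≤-refl
                          in ℕ.<-irrefl refl (greatest (suc r) (FullAt⇒≤ (fromℕ< 1≤n) full) full)
    in r , ((λ j 1≤j j≤r → FullAt-downward 1≤j j≤r full-r) , not-richer)
         , (1≤r , r≤n , full-r) , λ k _ k≤n → greatest k k≤n

lemma5p5 : (n : ℕ) → 1 ≤ n → (D : Domain n) → IsMaximalASPD D →
    ((a : Fin n) (ω : Pref n) → D ω → (k : Fin n) → lookup ω k ≡ a →
    (j : Fin n) → j ≤ᶠ k → ∃ λ ω′ → D ω′ × lookup ω′ j ≡ a)
    × (Σ ℕ λ r → IsRich D r × IsMaxFull D r)
lemma5p5 n 1≤n D maximal = up , rich-is-greatest-full 1≤n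
  where
  open MaximalASPD maximal
  up : (a : Fin n) (ω : Pref n) → D ω → (k : Fin n) → lookup ω k ≡ a →
    (j : Fin n) → j ≤ᶠ k → ∃ λ ω′ → D ω′ × lookup ω′ j ≡ a
  up a ω ω∈D k ωk≡a j j≤k = let ν , ν∈D , νj≡ωk = move-up ω∈D j≤k in ν , ν∈D , trans νj≡ωk ωk≡a
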